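{- Let $G=(W,B,E)$ be a finite bipartite graph having at least one perfect matching, embedded in a closed Riemann surface $X$ of genus $g$, and let $w:E\to\mathbb C\setminus\{0\}$ be a Kasteleyn flat weight function satisfying $c(C)\in\{1,-1\}$ for every oriented cycle $C$ of $G$. Then $w$ is equivalent to a simple Kasteleyn flat weight function $w'$ (i.e. Kasteleyn flat with $w'(e)\in\{1,-1\}$ for all $e\in E$).
   Context: $W$ (white) and $B$ (black) partition the vertices and each edge joins a white and a black vertex. Let $O$ be the orientation of $G$ in which each edge points from its black to its white vertex. For a cycle $C$ of $G$ with a chosen direction of traversal, let $C_+$ be the edges of $C$ whose traversal direction agrees with $O$ and $C_-=C\setminus C_+$; the Kasteleyn curvature is $c(C)=(-1)^{|C|/2+1}\prod_{e\in C_+}w(e)/\prod_{e\in C_- }w(e)$. $w$ is Kasteleyn flat if $c(F)=1$ for every facial cycle $F$ of the embedding (with either orientation). Two weight functions are equivalent if one is obtained from the other by finitely many vertex multiplications, a vertex multiplication meaning: choose a vertex $v$ and $c\in\mathbb C\setminus\{0\}$ and multiply by $c$ the weights of all edges incident with $v$. -}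

module Defs where

open import Level using (Level; _⊔_) renaming (suc to lsuc)
open import Algebra.Bundles using (CommutativeRing)
open import Data.Nat using (ℕ; zero; suc; _≤_)
import Data.Nat as ℕ
open import Data.Fin using (Fin; _≟_)
open import Data.Bool using (Bool; true; false; not)
open import Data.Product using (Σ; ∃; _,_; proj₁; proj₂) renaming (_×_ to _∧_)
open import Data.Sum using (_⊎_; inj₁; inj₂)
open import Data.Sum.Properties using (≡-dec)
open import Data.List using (List; []; _∷_; length; map; reverse; _++_; [_]; foldr)
open import Data.List.Relation.Unary.Unique.Propositional using (Unique)
open import Data.Unit using (⊤)
open import Data.Empty using (⊥)
open import Relation.Nullary using (¬_; yes; no)
open import Relation.Binary.PropositionalEquality using (_≡_)
open import Function.Bundles using (_↔_; Inverse)

-- The coefficient field: an algebraically closed field of characteristic 0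
-- (the first-order theory of such fields is that of ℂ).

module _ {c ℓ : Level} (R : CommutativeRing c ℓ) where
  open CommutativeRing R

  natCast : ℕ → Carrier
  natCast zero    = 0#
  natCast (suc n) = 1# + natCast n

  -- evalMonic (a₀ ∷ … ∷ a_{n-1}) x = a₀ + a₁x + … + a_{n-1}x^{n-1} + x^n
  evalMonic : List Carrier → Carrier → Carrier
  evalMonic []       x = 1#
  evalMonic (a ∷ as) x = a + x * evalMonic as x

record ACField (c ℓ : Level) : Set (lsuc (c ⊔ ℓ)) where
  field
    cring : CommutativeRing c ℓ
  open CommutativeRing cring public
  field
    _⁻¹        : Carrier → Carrier
    0≉1        : ¬ (0# ≈ 1#)
    inverse    : ∀ x → ¬ (x ≈ 0#) → (x * (x ⁻¹)) ≈ 1#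
    char0      : ∀ n → ¬ (natCast cring (suc n) ≈ 0#)
    algClosed  : ∀ (a : Carrier) (as : List Carrier) → ∃ λ x → evalMonic cring (a ∷ as) x ≈ 0#

record BipGraph : Set where
  field
    nB nW m : ℕ
    black   : Fin m → Fin nB
    white   : Fin m → Fin nW

module _ (G : BipGraph) where
  open BipGraph G

  Vertex : Set
  Vertex = Fin nB ⊎ Fin nW

  -- a dart = an edge with a direction of traversal;
  -- true : black → white (agrees with O), false : white → black
  Dart : Set
  Dart = Fin m ∧ Bool

  edge : Dart → Fin m
  edge = proj₁

  tail : Dart → Vertex
  tail (e , true)  = inj₁ (black e)
  tail (e , false) = inj₂ (white e)

  rev : Dart → Dart
  rev (e , b) = (e , not b)

  head : Dart → Vertex
  head d = tail (rev d)

  HasPerfectMatching : Set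
  HasPerfectMatching =
    Σ (Fin nB → Fin m) λ μ →
      (∀ b → black (μ b) ≡ b)
      ∧ (∀ b b' → white (μ b) ≡ white (μ b') → b ≡ b')
      ∧ (∀ x → ∃ λ b → white (μ b) ≡ x)

  Chain : List Dart → Set
  Chain []            = ⊤
  Chain (d ∷ [])      = ⊤
  Chain (d ∷ d' ∷ ds) = (head d ≡ tail d') ∧ Chain (d' ∷ ds)

  IsCycle : List Dart → Set
  IsCycle []       = ⊥
  IsCycle (d ∷ ds) =
    (2 ≤ length (d ∷ ds))
    ∧ Chain ((d ∷ ds) ++ [ d ])
    ∧ Unique (map tail (d ∷ ds))
    ∧ Unique (map edge (d ∷ ds))

  reverseCycle : List Dart → List Dart
  reverseCycle ds = map rev (reverse ds)

  iter : {A : Set} → (A → A) → ℕ → A → A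
  iter f zero    a = a
  iter f (suc k) a = f (iter f k a)

  -- Embedding of G in a closed orientable surface, given combinatorially by
  -- a rotation system: σ cyclically permutes the darts leaving each vertex.
  record RotationSystem : Set where
    field
      σ          : Dart ↔ Dart
    rot : Dart → Dart
    rot = Inverse.to σ
    field
      rot-tail   : ∀ d → tail (rot d) ≡ tail d
      rot-cyclic : ∀ d d' → tail d ≡ tail d' → ∃ λ k → iter rot k d ≡ d'

    φ : Dart → Dart
    φ d = rot (rev d)

    orbit : Dart → ℕ → List Dart
    orbit d zero    = []
    orbit d (suc k) = d ∷ orbit (φ d) k

    IsFacial : List Dart → Set
    IsFacial ds = ∃ λ d → (ds ≡ orbit d (length ds)) ∧ (iter φ (length ds) d ≡ d)

  module _ {c ℓ : Level} (K : ACField c ℓ) where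
    open ACField K

    Weight : Set c
    Weight = Fin m → Carrier

    NonZeroWeight : Weight → Set ℓ
    NonZeroWeight w = ∀ e → ¬ (w e ≈ 0#)

    negOnePow : ℕ → Carrier
    negOnePow zero    = 1#
    negOnePow (suc n) = - (negOnePow n)

    prod : List Carrier → Carrier
    prod = foldr _*_ 1#

    dartFactor : Weight → Dart → Carrier
    dartFactor w (e , true)  = w e
    dartFactor w (e , false) = (w e) ⁻¹

    curvature : Weight → List Dart → Carrier
    curvature w ds = negOnePow ((length ds ℕ./ 2) ℕ.+ 1) * prod (map (dartFactor w) ds)

    KasteleynFlat : RotationSystem → Weight → Set ℓ
    KasteleynFlat X w = ∀ ds → IsCycle ds → RotationSystem.IsFacial X ds →
      (curvature w ds ≈ 1#) ∧ (curvature w (reverseCycle ds) ≈ 1#)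

    incident : Vertex → Fin m → Bool
    incident v e with ≡-dec _≟_ _≟_ v (inj₁ (black e)) | ≡-dec _≟_ _≟_ v (inj₂ (white e))
    ... | yes _ | _     = true
    ... | no _  | yes _ = true
    ... | no _  | no _  = false

    vmul : Vertex → Carrier → Weight → Weight
    vmul v a w e with incident v e
    ... | true  = a * w e
    ... | false = w e

    data Equivalent : Weight → Weight → Set (c ⊔ ℓ) where
      done : ∀ {w w'} → (∀ e → w e ≈ w' e) → Equivalent w w'
      step : ∀ {w w'} (v : Vertex) (a : Carrier) → ¬ (a ≈ 0#) →
             Equivalent (vmul v a w) w' → Equivalent w w'

    Simple : Weight → Set ℓ
    Simple w = ∀ e → (w e ≈ 1#) ⊎ (w e ≈ - 1#)

-- A gauge transformation (multiplying the edges at each vertex v by g v ≠ 0) changes the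
-- weight of every dart by a factor φ(tail)/φ(head), so it fixes the curvature of every
-- cycle and hence Kasteleyn flatness. A gauge making all weights ±1 is built by adding
-- the edges one at a time while tracking the connected components of the edges added so
-- far, with simple paths inside them. An edge between two components is given weight 1
-- by rescaling one of them (black vertices by t, white ones by t⁻¹, which leaves its
-- inner edges unchanged); an edge inside a component closes a simple cycle whose other
-- edges already have weight ±1, so its own weight is ±1 because the curvature is.

module Submission where

open import Defs
open import Level using (Level; _⊔_)
open import Data.Product using (∃; _,_; proj₁; proj₂) renaming (_×_ to _∧_)
open import Data.Sum using (_⊎_; inj₁; inj₂)
open import Relation.Nullary using (¬_; Dec; yes; no; does)
open import Relation.Nullary.Decidable using (dec-true; dec-false)
open import Relation.Binary.Definitions using (DecidableEquality)
open import Relation.Binary.PropositionalEquality as ≡ using (_≡_; _≢_; refl)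
open import Data.Bool using (true; false; if_then_else_)
open import Data.Bool.Properties using (¬-not)
open import Data.Fin using (Fin; _≟_)
open import Data.List using (List; []; _∷_; length; _++_; [_]; map; reverse; allFin)
open import Data.List.Properties using (map-++; unfold-reverse; reverse-map)
open import Data.List.Relation.Unary.All as All using (All; []; _∷_)
open import Data.List.Relation.Unary.Any using (here; there)
open import Data.List.Relation.Unary.AllPairs using ([]; _∷_)
open import Data.List.Membership.Propositional using (_∈_; _∉_)
open import Data.List.Membership.Propositional.Properties using (∈-map⁺; ∈-map⁻; ∈-allFin)
open import Data.List.Relation.Unary.Unique.Propositional using (Unique)
open import Data.Empty using (⊥-elim)
import Data.List.Relation.Unary.Unique.Propositional.Properties as UP
import Data.List.Relation.Unary.All.Properties as AllP
open import Data.Nat using (zero; suc; s≤s; z≤n)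
import Data.Nat as ℕ
open import Function using (id; _∘_)
open import Data.Sum.Properties using (≡-dec; inj₁-injective; inj₂-injective)

module FieldProperties {c ℓ : Level} (K : ACField c ℓ) where
  open ACField K
  open import Relation.Binary.Reasoning.Setoid setoid
  open import Algebra.Properties.CommutativeSemigroup *-commutativeSemigroup
    using (interchange; x∙yz≈y∙xz; xy∙z≈y∙xz)
  open import Algebra.Properties.Ring ring using (-1*x≈-x; -‿involutive)

  infix 4 _≉0

  _≉0 : Carrier → Set ℓ
  x ≉0 = ¬ (x ≈ 0#)

  1≉0 : 1# ≉0
  1≉0 1≈0 = 0≉1 (sym 1≈0)

  ⁻¹-inverseˡ : ∀ {x} → x ≉0 → x ⁻¹ * x ≈ 1#
  ⁻¹-inverseˡ {x} x≉0 = trans (*-comm (x ⁻¹) x) (inverse x x≉0)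

  ⁻¹-unique : ∀ {x y} → x ≉0 → x * y ≈ 1# → y ≈ x ⁻¹
  ⁻¹-unique {x} {y} x≉0 xy≈1 = begin
    y                ≈⟨ *-identityʳ y ⟨
    y * 1#           ≈⟨ *-congˡ (inverse x x≉0) ⟨
    y * (x * x ⁻¹)   ≈⟨ *-assoc y x (x ⁻¹) ⟨
    (y * x) * x ⁻¹   ≈⟨ *-congʳ (trans (*-comm y x) xy≈1) ⟩
    1# * x ⁻¹        ≈⟨ *-identityˡ (x ⁻¹) ⟩
    x ⁻¹             ∎

  *-≉0 : ∀ {x y} → x ≉0 → y ≉0 → x * y ≉0
  *-≉0 {x} {y} x≉0 y≉0 xy≈0 = 0≉1 (begin
    0#                       ≈⟨ zeroˡ (y ⁻¹ * x ⁻¹) ⟨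
    0# * (y ⁻¹ * x ⁻¹)       ≈⟨ *-congʳ xy≈0 ⟨
    (x * y) * (y ⁻¹ * x ⁻¹)  ≈⟨ *-assoc x y (y ⁻¹ * x ⁻¹) ⟩
    x * (y * (y ⁻¹ * x ⁻¹))  ≈⟨ *-congˡ (*-assoc y (y ⁻¹) (x ⁻¹)) ⟨
    x * ((y * y ⁻¹) * x ⁻¹)  ≈⟨ *-congˡ (*-congʳ (inverse y y≉0)) ⟩
    x * (1# * x ⁻¹)          ≈⟨ *-congˡ (*-identityˡ (x ⁻¹)) ⟩
    x * x ⁻¹                 ≈⟨ inverse x x≉0 ⟩
    1#                       ∎)

  ⁻¹-≉0 : ∀ {x} → x ≉0 → x ⁻¹ ≉0
  ⁻¹-≉0 {x} x≉0 x⁻¹≈0 = 0≉1 (begin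
    0#        ≈⟨ zeroʳ x ⟨
    x * 0#    ≈⟨ *-congˡ x⁻¹≈0 ⟨
    x * x ⁻¹  ≈⟨ inverse x x≉0 ⟩
    1#        ∎)

  ⁻¹-involutive : ∀ {x} → x ≉0 → x ⁻¹ ⁻¹ ≈ x
  ⁻¹-involutive x≉0 = sym (⁻¹-unique (⁻¹-≉0 x≉0) (⁻¹-inverseˡ x≉0))

  ⁻¹-distrib-* : ∀ {x y} → x ≉0 → y ≉0 → (x * y) ⁻¹ ≈ x ⁻¹ * y ⁻¹
  ⁻¹-distrib-* {x} {y} x≉0 y≉0 = sym (⁻¹-unique (*-≉0 x≉0 y≉0) (begin
    (x * y) * (x ⁻¹ * y ⁻¹)  ≈⟨ interchange x y (x ⁻¹) (y ⁻¹) ⟩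
    (x * x ⁻¹) * (y * y ⁻¹)  ≈⟨ *-cong (inverse x x≉0) (inverse y y≉0) ⟩
    1# * 1#                  ≈⟨ *-identityˡ 1# ⟩
    1#                       ∎))

  *-cancel-middle : ∀ {x y z} → y ≉0 → (x * y ⁻¹) * (y * z) ≈ x * z
  *-cancel-middle {x} {y} {z} y≉0 = begin
    (x * y ⁻¹) * (y * z)  ≈⟨ *-assoc x (y ⁻¹) (y * z) ⟩
    x * (y ⁻¹ * (y * z))  ≈⟨ *-congˡ (*-assoc (y ⁻¹) y z) ⟨
    x * ((y ⁻¹ * y) * z)  ≈⟨ *-congˡ (*-congʳ (⁻¹-inverseˡ y≉0)) ⟩
    x * (1# * z)          ≈⟨ *-congˡ (*-identityˡ z) ⟩
    x * z                 ∎

  *-rescale : ∀ {t} → t ≉0 → ∀ a b c → (a * t ⁻¹) * ((b * t) * c) ≈ a * (b * c)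
  *-rescale {t} t≉0 a b c = begin
    (a * t ⁻¹) * ((b * t) * c)  ≈⟨ *-congˡ (xy∙z≈y∙xz b t c) ⟩
    (a * t ⁻¹) * (t * (b * c))  ≈⟨ *-cancel-middle t≉0 ⟩
    a * (b * c)                 ∎

  -1*-1≈1 : - 1# * - 1# ≈ 1#
  -1*-1≈1 = trans (-1*x≈-x (- 1#)) (-‿involutive 1#)

  -1≉0 : - 1# ≉0
  -1≉0 -1≈0 = 1≉0 (begin
    1#           ≈⟨ -1*-1≈1 ⟨
    - 1# * - 1#  ≈⟨ *-congˡ -1≈0 ⟩
    - 1# * 0#    ≈⟨ zeroʳ (- 1#) ⟩
    0#           ∎)

  IsSign : Carrier → Set ℓ
  IsSign x = (x ≈ 1#) ⊎ (x ≈ - 1#)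

  sign-resp : ∀ {x y} → x ≈ y → IsSign x → IsSign y
  sign-resp x≈y (inj₁ x≈1)  = inj₁ (trans (sym x≈y) x≈1)
  sign-resp x≈y (inj₂ x≈-1) = inj₂ (trans (sym x≈y) x≈-1)

  sign⇒≉0 : ∀ {x} → IsSign x → x ≉0
  sign⇒≉0 (inj₁ x≈1)  x≈0 = 1≉0 (trans (sym x≈1) x≈0)
  sign⇒≉0 (inj₂ x≈-1) x≈0 = -1≉0 (trans (sym x≈-1) x≈0)

  sign-square : ∀ {x} → IsSign x → x * x ≈ 1#
  sign-square (inj₁ x≈1)  = trans (*-cong x≈1 x≈1) (*-identityˡ 1#)
  sign-square (inj₂ x≈-1) = trans (*-cong x≈-1 x≈-1) -1*-1≈1

  sign-* : ∀ {x y} → IsSign x → IsSign y → IsSign (x * y)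
  sign-* (inj₁ x≈1)  (inj₁ y≈1)  = inj₁ (trans (*-cong x≈1 y≈1) (*-identityˡ 1#))
  sign-* (inj₁ x≈1)  (inj₂ y≈-1) = inj₂ (trans (*-cong x≈1 y≈-1) (*-identityˡ (- 1#)))
  sign-* (inj₂ x≈-1) (inj₁ y≈1)  = inj₂ (trans (*-cong x≈-1 y≈1) (*-identityʳ (- 1#)))
  sign-* (inj₂ x≈-1) (inj₂ y≈-1) = inj₁ (trans (*-cong x≈-1 y≈-1) -1*-1≈1)

  sign-⁻¹ : ∀ {x} → IsSign x → IsSign (x ⁻¹)
  sign-⁻¹ {x} x± = sign-resp (⁻¹-unique (sign⇒≉0 x±) (sign-square x±)) x±

  sign-‿ : ∀ {x} → IsSign x → IsSign (- x)
  sign-‿ (inj₁ x≈1)  = inj₂ (-‿cong x≈1)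
  sign-‿ (inj₂ x≈-1) = inj₁ (trans (-‿cong x≈-1) (-‿involutive 1#))

  sign-cancel : ∀ {s t a} → IsSign s → IsSign t → IsSign (s * (a * t)) → IsSign a
  sign-cancel {s} {t} {a} s± t± sat± = sign-resp s[at]*st≈a (sign-* sat± (sign-* s± t±))
    where
    s[at]*st≈a : (s * (a * t)) * (s * t) ≈ a
    s[at]*st≈a = begin
      (s * (a * t)) * (s * t)  ≈⟨ *-congʳ (x∙yz≈y∙xz s a t) ⟩
      (a * (s * t)) * (s * t)  ≈⟨ *-assoc a (s * t) (s * t) ⟩
      a * ((s * t) * (s * t))  ≈⟨ *-congˡ (interchange s t s t) ⟩
      a * ((s * s) * (t * t))  ≈⟨ *-congˡ (*-cong (sign-square s±) (sign-square t±)) ⟩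
      a * (1# * 1#)            ≈⟨ *-congˡ (*-identityˡ 1#) ⟩
      a * 1#                   ≈⟨ *-identityʳ a ⟩
      a                        ∎

module Gauge {c ℓ : Level} (K : ACField c ℓ) (G : BipGraph) where
  open ACField K renaming (refl to ≈-refl; sym to ≈-sym; trans to ≈-trans)
  open FieldProperties K
  open BipGraph G
  open import Relation.Binary.Reasoning.Setoid setoid
  open import Algebra.Properties.CommutativeSemigroup *-commutativeSemigroup
    using (interchange; x∙yz≈yx∙z)

  _≟ᵥ_ : DecidableEquality (Vertex G)
  _≟ᵥ_ = ≡-dec _≟_ _≟_

  gauge : (Vertex G → Carrier) → Weight G K → Weight G K
  gauge g w e = g (inj₂ (white e)) * (g (inj₁ (black e)) * w e)

  incident-black : ∀ e → incident G K (inj₁ (black e)) e ≡ true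
  incident-black e with inj₁ (black e) ≟ᵥ inj₁ (black e)
  ... | yes _ = refl
  ... | no b≢b = ⊥-elim (b≢b refl)

  incident-white : ∀ e → incident G K (inj₂ (white e)) e ≡ true
  incident-white e with inj₂ (white e) ≟ᵥ inj₁ (black e) | inj₂ (white e) ≟ᵥ inj₂ (white e)
  ... | no _ | yes _ = refl
  ... | no _ | no x≢x = ⊥-elim (x≢x refl)

  incident-black⁻¹ : ∀ b e → incident G K (inj₁ b) e ≡ true → b ≡ black e
  incident-black⁻¹ b e _ with inj₁ b ≟ᵥ inj₁ (black e) | inj₁ b ≟ᵥ inj₂ (white e)
  incident-black⁻¹ b e _  | yes refl | _ = refl
  incident-black⁻¹ b e () | no _     | no _

  incident-white⁻¹ : ∀ x e → incident G K (inj₂ x) e ≡ true → x ≡ white e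
  incident-white⁻¹ x e _ with inj₂ x ≟ᵥ inj₁ (black e) | inj₂ x ≟ᵥ inj₂ (white e)
  incident-white⁻¹ x e _  | no _ | yes refl = refl
  incident-white⁻¹ x e () | no _ | no _

  vmul-incident : ∀ {v a U e} → incident G K v e ≡ true → vmul G K v a U e ≡ a * U e
  vmul-incident inc rewrite inc = refl

  vmul-unincident : ∀ {v a U e} → incident G K v e ≡ false → vmul G K v a U e ≡ U e
  vmul-unincident ¬inc rewrite ¬inc = refl

  allVertices : List (Vertex G)
  allVertices = map inj₁ (allFin nB) ++ map inj₂ (allFin nW)

  module _ (g : Vertex G → Carrier) where

    vmulAll : List (Vertex G) → Weight G K → Weight G K
    vmulAll []       U = U
    vmulAll (v ∷ vs) U = vmulAll vs (vmul G K v (g v) U)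

    vmulAll-++ : ∀ us vs U → vmulAll (us ++ vs) U ≡ vmulAll vs (vmulAll us U)
    vmulAll-++ []       vs U = refl
    vmulAll-++ (u ∷ us) vs U = vmulAll-++ us vs _

    vmulAll-unincident : ∀ {vs U e} → All (λ v → incident G K v e ≡ false) vs →
                         vmulAll vs U e ≡ U e
    vmulAll-unincident []             = refl
    vmulAll-unincident (¬inc ∷ ¬incs) = ≡.trans (vmulAll-unincident ¬incs) (vmul-unincident ¬inc)

    vmulAll-once : ∀ {vs t U e} → Unique vs → t ∈ vs → incident G K t e ≡ true →
                   (∀ {v} → v ∈ vs → incident G K v e ≡ true → v ≡ t) →
                   vmulAll vs U e ≈ g t * U e
    vmulAll-once (v∉vs ∷ _) (here refl) inc only = reflexive
      (≡.trans (vmulAll-unincident (All.tabulate λ v'∈vs →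
                  ¬-not λ inc' → All.lookup v∉vs v'∈vs (≡.sym (only (there v'∈vs) inc'))))
               (vmul-incident inc))
    vmulAll-once (v∉vs ∷ uniq) (there t∈vs) inc only = ≈-trans
      (vmulAll-once uniq t∈vs inc (λ v'∈vs → only (there v'∈vs)))
      (*-congˡ (reflexive (vmul-unincident (¬-not λ inc' →
        All.lookup v∉vs t∈vs (only (here refl) inc')))))

    vmulAll-allVertices : ∀ U e → vmulAll allVertices U e ≈ gauge g U e
    vmulAll-allVertices U e
      rewrite vmulAll-++ (map inj₁ (allFin nB)) (map inj₂ (allFin nW)) U = ≈-trans
        (vmulAll-once (UP.map⁺ inj₂-injective (UP.allFin⁺ nW))
                      (∈-map⁺ inj₂ (∈-allFin (white e))) (incident-white e) onlyWhite)
        (*-congˡ (vmulAll-once (UP.map⁺ inj₁-injective (UP.allFin⁺ nB))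
                               (∈-map⁺ inj₁ (∈-allFin (black e))) (incident-black e) onlyBlack))
      where
      onlyBlack : ∀ {v} → v ∈ map inj₁ (allFin nB) → incident G K v e ≡ true → v ≡ inj₁ (black e)
      onlyBlack v∈ inc with ∈-map⁻ inj₁ v∈
      ... | b , _ , refl = ≡.cong inj₁ (incident-black⁻¹ b e inc)
      onlyWhite : ∀ {v} → v ∈ map inj₂ (allFin nW) → incident G K v e ≡ true → v ≡ inj₂ (white e)
      onlyWhite v∈ inc with ∈-map⁻ inj₂ v∈
      ... | x , _ , refl = ≡.cong inj₂ (incident-white⁻¹ x e inc)

    vmulAll-equivalent : (∀ v → g v ≉0) → ∀ vs {U U'} → (∀ e → vmulAll vs U e ≈ U' e) →
                         Equivalent G K U U'
    vmulAll-equivalent g≉0 []       U≈U' = done U≈U'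
    vmulAll-equivalent g≉0 (v ∷ vs) U≈U' = step v (g v) (g≉0 v) (vmulAll-equivalent g≉0 vs U≈U')

  gauge-equivalent : ∀ {g} → (∀ v → g v ≉0) → ∀ w → Equivalent G K w (gauge g w)
  gauge-equivalent {g} g≉0 w = vmulAll-equivalent g g≉0 allVertices (vmulAll-allVertices g w)

  prod-++ : ∀ xs ys → prod G K (xs ++ ys) ≈ prod G K xs * prod G K ys
  prod-++ []       ys = ≈-sym (*-identityˡ (prod G K ys))
  prod-++ (x ∷ xs) ys = ≈-trans (*-congˡ (prod-++ xs ys)) (≈-sym (*-assoc x (prod G K xs) (prod G K ys)))

  prod-reverse : ∀ xs → prod G K (reverse xs) ≈ prod G K xs
  prod-reverse []       = ≈-refl
  prod-reverse (x ∷ xs) = begin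
    prod G K (reverse (x ∷ xs))        ≡⟨ ≡.cong (prod G K) (unfold-reverse x xs) ⟩
    prod G K (reverse xs ++ [ x ])     ≈⟨ prod-++ (reverse xs) [ x ] ⟩
    prod G K (reverse xs) * (x * 1#)   ≈⟨ *-cong (prod-reverse xs) (*-identityʳ x) ⟩
    prod G K xs * x                    ≈⟨ *-comm (prod G K xs) x ⟩
    x * prod G K xs                    ∎

  module Invariance {g : Vertex G → Carrier} (g≉0 : ∀ v → g v ≉0) where

    potential : Vertex G → Carrier
    potential (inj₁ b) = g (inj₁ b)
    potential (inj₂ x) = g (inj₂ x) ⁻¹

    potential-≉0 : ∀ v → potential v ≉0
    potential-≉0 (inj₁ b) = g≉0 (inj₁ b)
    potential-≉0 (inj₂ x) = ⁻¹-≉0 (g≉0 (inj₂ x))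

    gaugeFactor : Dart G → Carrier
    gaugeFactor d = potential (tail G d) * potential (head G d) ⁻¹

    gaugeFactors : List (Dart G) → Carrier
    gaugeFactors ds = prod G K (map gaugeFactor ds)

    dartFactor-gauge : ∀ {w} → NonZeroWeight G K w → ∀ d →
                       dartFactor G K (gauge g w) d ≈ gaugeFactor d * dartFactor G K w d
    dartFactor-gauge {w} w≉0 (e , true) = begin
      g x * (g b * w e)       ≈⟨ x∙yz≈yx∙z (g x) (g b) (w e) ⟩
      (g b * g x) * w e       ≈⟨ *-congʳ (*-congˡ (⁻¹-involutive (g≉0 x))) ⟨
      (g b * g x ⁻¹ ⁻¹) * w e ∎
      where b = inj₁ (black e) ; x = inj₂ (white e)
    dartFactor-gauge {w} w≉0 (e , false) = begin
      (g x * (g b * w e)) ⁻¹       ≈⟨ ⁻¹-distrib-* (g≉0 x) (*-≉0 (g≉0 b) (w≉0 e)) ⟩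
      g x ⁻¹ * (g b * w e) ⁻¹      ≈⟨ *-congˡ (⁻¹-distrib-* (g≉0 b) (w≉0 e)) ⟩
      g x ⁻¹ * (g b ⁻¹ * w e ⁻¹)   ≈⟨ *-assoc (g x ⁻¹) (g b ⁻¹) (w e ⁻¹) ⟨
      (g x ⁻¹ * g b ⁻¹) * w e ⁻¹   ∎
      where b = inj₁ (black e) ; x = inj₂ (white e)

    prod-dartFactor-gauge : ∀ {w} → NonZeroWeight G K w → ∀ ds →
      prod G K (map (dartFactor G K (gauge g w)) ds) ≈ gaugeFactors ds * prod G K (map (dartFactor G K w) ds)
    prod-dartFactor-gauge w≉0 []       = ≈-sym (*-identityˡ 1#)
    prod-dartFactor-gauge {w} w≉0 (d ∷ ds) = ≈-trans
      (*-cong (dartFactor-gauge w≉0 d) (prod-dartFactor-gauge w≉0 ds))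
      (interchange (gaugeFactor d) (dartFactor G K w d) (gaugeFactors ds) _)

    gaugeFactors-telescope : ∀ d ds d' → Chain G (d ∷ ds ++ [ d' ]) →
      gaugeFactors (d ∷ ds) ≈ potential (tail G d) * potential (tail G d') ⁻¹
    gaugeFactors-telescope d [] d' (head≡tail , _) = begin
      gaugeFactor d * 1#                            ≈⟨ *-identityʳ (gaugeFactor d) ⟩
      potential (tail G d) * potential (head G d) ⁻¹ ≡⟨ ≡.cong (λ v → potential (tail G d) * potential v ⁻¹) head≡tail ⟩
      potential (tail G d) * potential (tail G d') ⁻¹ ∎
    gaugeFactors-telescope d (r ∷ rs) d' (head≡tail , chain) = begin
      gaugeFactor d * gaugeFactors (r ∷ rs)
        ≈⟨ *-congˡ (gaugeFactors-telescope r rs d' chain) ⟩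
      gaugeFactor d * (potential (tail G r) * potential (tail G d') ⁻¹)
        ≡⟨ ≡.cong (λ v → gaugeFactor d * (potential v * potential (tail G d') ⁻¹)) head≡tail ⟨
      gaugeFactor d * (potential (head G d) * potential (tail G d') ⁻¹)
        ≈⟨ *-cancel-middle (potential-≉0 (head G d)) ⟩
      potential (tail G d) * potential (tail G d') ⁻¹ ∎

    gaugeFactors-cycle : ∀ ds → IsCycle G ds → gaugeFactors ds ≈ 1#
    gaugeFactors-cycle (d ∷ ds) (_ , closed , _) =
      ≈-trans (gaugeFactors-telescope d ds d closed) (inverse _ (potential-≉0 (tail G d)))

    gaugeFactor-rev : ∀ d → gaugeFactor (rev G d) * gaugeFactor d ≈ 1#
    gaugeFactor-rev (e , true)  = ≈-trans (*-cancel-middle (potential-≉0 (inj₁ (black e))))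
                                          (inverse _ (potential-≉0 (inj₂ (white e))))
    gaugeFactor-rev (e , false) = ≈-trans (*-cancel-middle (potential-≉0 (inj₂ (white e))))
                                          (inverse _ (potential-≉0 (inj₁ (black e))))

    gaugeFactors-rev : ∀ ds → gaugeFactors (map (rev G) ds) * gaugeFactors ds ≈ 1#
    gaugeFactors-rev []       = *-identityˡ 1#
    gaugeFactors-rev (d ∷ ds) = begin
      (gaugeFactor (rev G d) * gaugeFactors (map (rev G) ds)) * (gaugeFactor d * gaugeFactors ds)
        ≈⟨ interchange (gaugeFactor (rev G d)) _ (gaugeFactor d) _ ⟩
      (gaugeFactor (rev G d) * gaugeFactor d) * (gaugeFactors (map (rev G) ds) * gaugeFactors ds)
        ≈⟨ *-cong (gaugeFactor-rev d) (gaugeFactors-rev ds) ⟩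
      1# * 1#
        ≈⟨ *-identityˡ 1# ⟩
      1# ∎

    gaugeFactors-reverseCycle : ∀ ds → gaugeFactors ds ≈ 1# → gaugeFactors (reverseCycle G ds) ≈ 1#
    gaugeFactors-reverseCycle ds ds≈1 = begin
      gaugeFactors rds                    ≈⟨ *-identityʳ (gaugeFactors rds) ⟨
      gaugeFactors rds * 1#               ≈⟨ *-congˡ ds≈1 ⟨
      gaugeFactors rds * gaugeFactors ds  ≈⟨ *-congˡ (prod-reverse (map gaugeFactor ds)) ⟨
      gaugeFactors rds * prod G K (reverse (map gaugeFactor ds))
        ≡⟨ ≡.cong (λ fs → gaugeFactors rds * prod G K fs) (reverse-map gaugeFactor ds) ⟨
      gaugeFactors rds * gaugeFactors (reverse ds) ≈⟨ gaugeFactors-rev (reverse ds) ⟩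
      1#                                  ∎
      where rds = map (rev G) (reverse ds)

    curvature-gauge : ∀ {w} → NonZeroWeight G K w → ∀ ds → gaugeFactors ds ≈ 1# →
                      curvature G K (gauge g w) ds ≈ curvature G K w ds
    curvature-gauge w≉0 ds ds≈1 = *-congˡ (≈-trans (prod-dartFactor-gauge w≉0 ds)
      (≈-trans (*-congʳ ds≈1) (*-identityˡ _)))

    curvature-gauge-cycle : ∀ {w} → NonZeroWeight G K w → ∀ ds → IsCycle G ds →
                            curvature G K (gauge g w) ds ≈ curvature G K w ds
    curvature-gauge-cycle w≉0 ds cyc = curvature-gauge w≉0 ds (gaugeFactors-cycle ds cyc)

    kasteleynFlat-gauge : ∀ {X w} → NonZeroWeight G K w → KasteleynFlat G K X w →
                          KasteleynFlat G K X (gauge g w)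
    kasteleynFlat-gauge w≉0 flat ds cyc facial =
        ≈-trans (curvature-gauge w≉0 ds ds≈1) (proj₁ (flat ds cyc facial))
      , ≈-trans (curvature-gauge w≉0 (reverseCycle G ds) (gaugeFactors-reverseCycle ds ds≈1))
                (proj₂ (flat ds cyc facial))
      where ds≈1 = gaugeFactors-cycle ds cyc

module Paths (G : BipGraph) where
  open BipGraph G
  open import Data.List.Relation.Binary.Permutation.Setoid.Properties (≡.setoid (Vertex G))
    using (Unique-resp-↭; ++-comm)

  data Walk : Vertex G → Vertex G → List (Dart G) → Set where
    []  : ∀ {v} → Walk v v []
    _∷_ : ∀ {u v d ds} → tail G d ≡ u → Walk (head G d) v ds → Walk u v (d ∷ ds)

  _++ʷ_ : ∀ {u y v ds ds'} → Walk u y ds → Walk y v ds' → Walk u v (ds ++ ds')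
  []            ++ʷ q = q
  (tail≡u ∷ p)  ++ʷ q = tail≡u ∷ (p ++ʷ q)

  walk-chain : ∀ {u v ds} d₀ d → Walk u v ds → head G d₀ ≡ u → tail G d ≡ v →
               Chain G (d₀ ∷ ds ++ [ d ])
  walk-chain d₀ d []                      d₀→u d←v = ≡.trans d₀→u (≡.sym d←v) , _
  walk-chain d₀ d (_∷_ {d = d₁} tail≡u p) d₀→u d←v =
    ≡.trans d₀→u (≡.sym tail≡u) , walk-chain d₁ d p refl d←v

  walk-tails : ∀ {u v ds} → Walk u v ds → map (tail G) ds ++ [ v ] ≡ u ∷ map (head G) ds
  walk-tails []           = refl
  walk-tails (tail≡u ∷ p) = ≡.cong₂ _∷_ tail≡u (walk-tails p)

  record ComponentPath (L : Vertex G → Vertex G) (es : List (Fin m)) (u v : Vertex G) : Set where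
    field
      darts           : List (Dart G)
      walk            : Walk u v darts
      vertices-unique : Unique (u ∷ map (head G) darts)
      edges-unique    : Unique (map (edge G) darts)
      edges-in        : All (λ d → edge G d ∈ es) darts
      in-component    : All (λ d → L (head G d) ≡ L u) darts

  open ComponentPath

  emptyPath : ∀ {L es v} → ComponentPath L es v v
  emptyPath = record
    { darts = [] ; walk = [] ; vertices-unique = [] ∷ [] ; edges-unique = []
    ; edges-in = [] ; in-component = [] }

  onPath-label : ∀ {L es u v} (p : ComponentPath L es u v) {y} →
                 y ∈ u ∷ map (head G) (darts p) → L y ≡ L u
  onPath-label p (here refl) = refl
  onPath-label p (there y∈) with ∈-map⁻ (head G) y∈
  ... | _ , d∈ , refl = All.lookup (in-component p) d∈

  ComponentPath-weaken : ∀ {L es u v} (f : Vertex G → Vertex G) e →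
                         ComponentPath L es u v → ComponentPath (f ∘ L) (e ∷ es) u v
  ComponentPath-weaken f e p = record
    { darts = darts p ; walk = walk p
    ; vertices-unique = vertices-unique p ; edges-unique = edges-unique p
    ; edges-in = All.map there (edges-in p) ; in-component = All.map (≡.cong f) (in-component p) }

  edges-∉ : ∀ {es e ds} → e ∉ es → All (λ d → edge G d ∈ es) ds → All (λ d → e ≢ edge G d) ds
  edges-∉ e∉es = All.map λ d∈es e≡d → e∉es (≡.subst (_∈ _) (≡.sym e≡d) d∈es)

  closingCycle : ∀ {L es e} → e ∉ es → (p : ComponentPath L es (inj₂ (white e)) (inj₁ (black e))) →
                 IsCycle G ((e , true) ∷ darts p)
  closingCycle {e = e} e∉es p with darts p | walk p | vertices-unique p | edges-unique p | edges-in p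
  ... | d₁ ∷ ds | walk | vertices | edges | edges-in =
      s≤s (s≤s z≤n)
    , walk-chain (e , true) (e , true) walk refl refl
    , Unique-resp-↭ (++-comm (map (tail G) (d₁ ∷ ds)) [ inj₁ (black e) ])
                    (≡.subst Unique (≡.sym (walk-tails walk)) vertices)
    , AllP.map⁺ (edges-∉ e∉es edges-in) ∷ edges

  module _ {L : Vertex G → Vertex G} {es : List (Fin m)}
           (label-edge : ∀ e → e ∈ es → L (inj₁ (black e)) ≡ L (inj₂ (white e))) where

    label-black : ∀ d {γ} → edge G d ∈ es → L (head G d) ≡ γ → L (inj₁ (black (edge G d))) ≡ γ
    label-black (e , true)  e∈es head≡γ = ≡.trans (label-edge e e∈es) head≡γ
    label-black (e , false) e∈es head≡γ = head≡γ

    join : ∀ {L' u y v} d → edge G d ∉ es → L u ≢ L (head G d) →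
           (∀ z → L z ≡ L u → L' z ≡ L' u) → (∀ z → L z ≡ L (head G d) → L' z ≡ L' u) →
           ComponentPath L es u y → tail G d ≡ y → ComponentPath L es (head G d) v →
           ComponentPath L' (edge G d ∷ es) u v
    join {L'} {u} d d∉es Lu≢Ld toLu toLd p tail≡y q = record
      { darts           = darts p ++ d ∷ darts q
      ; walk            = walk p ++ʷ (tail≡y ∷ walk q)
      ; vertices-unique = ≡.subst Unique (≡.cong (u ∷_) (≡.sym (map-++ (head G) (darts p) (d ∷ darts q))))
                            (UP.++⁺ (vertices-unique p) (vertices-unique q) disjoint-vertices)
      ; edges-unique    = ≡.subst Unique (≡.sym (map-++ (edge G) (darts p) (d ∷ darts q)))
                            (UP.++⁺ (edges-unique p) (AllP.map⁺ (edges-∉ d∉es (edges-in q)) ∷ edges-unique q)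
                                    disjoint-edges)
      ; edges-in        = AllP.++⁺ (All.map there (edges-in p)) (here refl ∷ All.map there (edges-in q))
      ; in-component    = AllP.++⁺ (All.map (toLu _) (in-component p))
                                   (toLd (head G d) refl ∷ All.map (toLd _) (in-component q))
      }
      where
      disjoint-vertices : ∀ {z} → ¬ (z ∈ u ∷ map (head G) (darts p) ∧ z ∈ head G d ∷ map (head G) (darts q))
      disjoint-vertices (z∈p , z∈q) = Lu≢Ld (≡.trans (≡.sym (onPath-label p z∈p)) (onPath-label q z∈q))

      disjoint-edges : ∀ {e} → ¬ (e ∈ map (edge G) (darts p) ∧ e ∈ edge G d ∷ map (edge G) (darts q))
      disjoint-edges (e∈p , e∈dq) with ∈-map⁻ (edge G) e∈p
      disjoint-edges (e∈p , here refl) | d₁ , d₁∈p , d≡d₁ =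
        d∉es (≡.subst (_∈ es) (≡.sym d≡d₁) (All.lookup (edges-in p) d₁∈p))
      disjoint-edges (e∈p , there e∈q) | d₁ , d₁∈p , refl with ∈-map⁻ (edge G) e∈q
      ... | d₂ , d₂∈q , d₁≡d₂ = Lu≢Ld (begin
        L u                                 ≡⟨ label-black d₁ (All.lookup (edges-in p) d₁∈p)
                                                 (All.lookup (in-component p) d₁∈p) ⟨
        L (inj₁ (black (edge G d₁)))        ≡⟨ ≡.cong (λ e → L (inj₁ (black e))) d₁≡d₂ ⟩
        L (inj₁ (black (edge G d₂)))        ≡⟨ label-black d₂ (All.lookup (edges-in q) d₂∈q)
                                                 (All.lookup (in-component q) d₂∈q) ⟩
        L (head G d)                        ∎)
        where open ≡.≡-Reasoning

module Construction {c ℓ : Level} (K : ACField c ℓ) (G : BipGraph)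
  {w : Weight G K} (w≉0 : NonZeroWeight G K w)
  (cycle-sign : ∀ ds → IsCycle G ds → FieldProperties.IsSign K (curvature G K w ds)) where
  open ACField K renaming (refl to ≈-refl; sym to ≈-sym; trans to ≈-trans)
  open FieldProperties K
  open BipGraph G
  open Gauge K G
  open Paths G
  open ComponentPath
  open import Relation.Binary.Reasoning.Setoid setoid
  open import Algebra.Properties.CommutativeSemigroup *-commutativeSemigroup using (xy∙z≈xz∙y)

  sign-negOnePow : ∀ n → IsSign (negOnePow G K n)
  sign-negOnePow zero    = inj₁ ≈-refl
  sign-negOnePow (suc n) = sign-‿ (sign-negOnePow n)

  sign-prod-dartFactor : ∀ {w' es} ds → All (λ d → edge G d ∈ es) ds → (∀ e → e ∈ es → IsSign (w' e)) →
                         IsSign (prod G K (map (dartFactor G K w') ds))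
  sign-prod-dartFactor []                _            _    = inj₁ ≈-refl
  sign-prod-dartFactor ((e , true)  ∷ ds) (e∈ ∷ ds∈) sign = sign-* (sign e e∈) (sign-prod-dartFactor ds ds∈ sign)
  sign-prod-dartFactor ((e , false) ∷ ds) (e∈ ∷ ds∈) sign =
    sign-* (sign-⁻¹ (sign e e∈)) (sign-prod-dartFactor ds ds∈ sign)

  sign-closingEdge : ∀ {g L es e} → (∀ v → g v ≉0) → e ∉ es → (∀ e' → e' ∈ es → IsSign (gauge g w e')) →
                     ComponentPath L es (inj₂ (white e)) (inj₁ (black e)) → IsSign (gauge g w e)
  sign-closingEdge {g} {e = e} g≉0 e∉es sign p =
    sign-cancel (sign-negOnePow (length C ℕ./ 2 ℕ.+ 1)) (sign-prod-dartFactor (darts p) (edges-in p) sign)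
      (sign-resp (≈-sym (curvature-gauge-cycle w≉0 C cycle)) (cycle-sign C cycle))
    where
    open Invariance g≉0
    C = (e , true) ∷ darts p
    cycle = closingCycle e∉es p

  record SignGauge (es : List (Fin m)) : Set (c ⊔ ℓ) where
    field
      label      : Vertex G → Vertex G
      g          : Vertex G → Carrier
      g≉0        : ∀ v → g v ≉0
      sign       : ∀ e → e ∈ es → IsSign (gauge g w e)
      label-edge : ∀ e → e ∈ es → label (inj₁ (black e)) ≡ label (inj₂ (white e))
      path       : ∀ u v → label u ≡ label v → ComponentPath label es u v

  initial : SignGauge []
  initial = record
    { label = λ v → v ; g = λ _ → 1# ; g≉0 = λ _ → 1≉0 ; sign = λ _ () ; label-edge = λ _ ()
    ; path = λ { u .u refl → emptyPath } }

  module Extend {e es} (e∉es : e ∉ es) (S : SignGauge es) where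
    open SignGauge S

    b x : Vertex G
    b = inj₁ (black e)
    x = inj₂ (white e)

    addInternalEdge : label b ≡ label x → SignGauge (e ∷ es)
    addInternalEdge b∼x = record
      { label      = label
      ; g          = g
      ; g≉0        = g≉0
      ; sign       = λ { _ (here refl) → sign-closingEdge g≉0 e∉es sign (path x b (≡.sym b∼x))
                       ; e' (there e'∈es) → sign e' e'∈es }
      ; label-edge = λ { _ (here refl) → b∼x ; e' (there e'∈es) → label-edge e' e'∈es }
      ; path       = λ u v u∼v → ComponentPath-weaken id e (path u v u∼v)
      }

    -- The class of x is merged into that of b and rescaled so that the new edge gets weight 1.
    module Bridge (b≁x : label b ≢ label x) where
      t : Carrier
      t = gauge g w e

      t≉0 : t ≉0
      t≉0 = *-≉0 (g≉0 x) (*-≉0 (g≉0 b) (w≉0 e))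

      relabel : Vertex G → Vertex G
      relabel z = if does (z ≟ᵥ label x) then label b else z

      relabel-yes : ∀ {z} → z ≡ label x → relabel z ≡ label b
      relabel-yes {z} z≡ rewrite dec-true (z ≟ᵥ label x) z≡ = refl

      relabel-no : ∀ {z} → z ≢ label x → relabel z ≡ z
      relabel-no {z} z≢ rewrite dec-false (z ≟ᵥ label x) z≢ = refl

      label' : Vertex G → Vertex G
      label' = relabel ∘ label

      side : Vertex G → Carrier
      side (inj₁ _) = t
      side (inj₂ _) = t ⁻¹

      g' : Vertex G → Carrier
      g' z = if does (label z ≟ᵥ label x) then g z * side z else g z

      g'-yes : ∀ {z} → label z ≡ label x → g' z ≡ g z * side z
      g'-yes {z} z∼x rewrite dec-true (label z ≟ᵥ label x) z∼x = refl

      g'-no : ∀ {z} → label z ≢ label x → g' z ≡ g z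
      g'-no {z} z≁x rewrite dec-false (label z ≟ᵥ label x) z≁x = refl

      g'≉0 : ∀ z → g' z ≉0
      g'≉0 (inj₁ β) with label (inj₁ β) ≟ᵥ label x
      ... | yes _ = *-≉0 (g≉0 (inj₁ β)) t≉0
      ... | no  _ = g≉0 (inj₁ β)
      g'≉0 (inj₂ ξ) with label (inj₂ ξ) ≟ᵥ label x
      ... | yes _ = *-≉0 (g≉0 (inj₂ ξ)) (⁻¹-≉0 t≉0)
      ... | no  _ = g≉0 (inj₂ ξ)

      gauge-old : ∀ e' → e' ∈ es → gauge g' w e' ≈ gauge g w e'
      gauge-old e' e'∈es = by-class (label (inj₁ (black e')) ≟ᵥ label x)
        where
        by-class : Dec (label (inj₁ (black e')) ≡ label x) → gauge g' w e' ≈ gauge g w e'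
        by-class (yes b'∼x) = ≈-trans
          (reflexive (≡.cong₂ (λ α β → α * (β * w e'))
            (g'-yes (≡.trans (≡.sym (label-edge e' e'∈es)) b'∼x)) (g'-yes b'∼x)))
          (*-rescale t≉0 _ _ _)
        by-class (no b'≁x) = reflexive (≡.cong₂ (λ α β → α * (β * w e'))
          (g'-no (λ x'∼x → b'≁x (≡.trans (label-edge e' e'∈es) x'∼x))) (g'-no b'≁x))

      gauge-bridge : gauge g' w e ≈ 1#
      gauge-bridge rewrite g'-yes {x} refl | g'-no b≁x = begin
        (g x * t ⁻¹) * (g b * w e)   ≈⟨ xy∙z≈xz∙y (g x) (t ⁻¹) (g b * w e) ⟩
        t * t ⁻¹                     ≈⟨ inverse t t≉0 ⟩
        1#                           ∎

      connect : ∀ u v → label' u ≡ label' v → Dec (label u ≡ label x) → Dec (label v ≡ label x) →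
                ComponentPath label' (e ∷ es) u v
      connect u v u∼'v (yes u∼x) (yes v∼x) =
        ComponentPath-weaken relabel e (path u v (≡.trans u∼x (≡.sym v∼x)))
      connect u v u∼'v (no u≁x)  (no v≁x)  =
        ComponentPath-weaken relabel e (path u v (≡.trans (≡.sym (relabel-no u≁x)) (≡.trans u∼'v (relabel-no v≁x))))
      connect u v u∼'v (yes u∼x) (no v≁x)  =
        join label-edge (e , false) e∉es (λ u∼b → b≁x (≡.trans (≡.sym u∼b) u∼x))
          (λ _ z∼u → ≡.cong relabel z∼u)
          (λ _ z∼b → ≡.trans (≡.cong relabel z∼b) (≡.trans (relabel-no b≁x) (≡.sym (relabel-yes u∼x))))
          (path u x u∼x) refl (path b v b∼v)
        where b∼v = ≡.trans (≡.sym (relabel-yes u∼x)) (≡.trans u∼'v (relabel-no v≁x))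
      connect u v u∼'v (no u≁x)  (yes v∼x) =
        join label-edge (e , true) e∉es u≁x
          (λ _ z∼u → ≡.cong relabel z∼u)
          (λ _ z∼x → ≡.trans (≡.cong relabel z∼x)
                       (≡.trans (relabel-yes refl) (≡.trans (≡.sym u∼b) (≡.sym (relabel-no u≁x)))))
          (path u b u∼b) refl (path x v (≡.sym v∼x))
        where u∼b = ≡.trans (≡.sym (relabel-no u≁x)) (≡.trans u∼'v (relabel-yes v∼x))

      addBridge : SignGauge (e ∷ es)
      addBridge = record
        { label      = label'
        ; g          = g'
        ; g≉0        = g'≉0
        ; sign       = λ { _ (here refl) → inj₁ gauge-bridge
                         ; e' (there e'∈es) → sign-resp (≈-sym (gauge-old e' e'∈es)) (sign e' e'∈es) }
        ; label-edge = λ { _ (here refl) → ≡.trans (relabel-no b≁x) (≡.sym (relabel-yes refl))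
                         ; e' (there e'∈es) → ≡.cong relabel (label-edge e' e'∈es) }
        ; path       = λ u v u∼'v → connect u v u∼'v (label u ≟ᵥ label x) (label v ≟ᵥ label x)
        }

    extend : SignGauge (e ∷ es)
    extend with label b ≟ᵥ label x
    ... | yes b∼x = addInternalEdge b∼x
    ... | no  b≁x = Bridge.addBridge b≁x

  build : ∀ es → Unique es → SignGauge es
  build []       []               = initial
  build (e ∷ es) (e∉es ∷ unique) = Extend.extend (AllP.All¬⇒¬Any e∉es) (build es unique)

proposition3p7 : ∀ {c ℓ : Level} (K : ACField c ℓ) (G : BipGraph) (X : RotationSystem G)
    → HasPerfectMatching G
    → (w : Weight G K)
    → NonZeroWeight G K w
    → KasteleynFlat G K X w
    → (∀ ds → IsCycle G ds
        → (ACField._≈_ K (curvature G K w ds) (ACField.1# K))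
          ⊎ (ACField._≈_ K (curvature G K w ds) (ACField.-_ K (ACField.1# K))))
    → ∃ λ w' → Equivalent G K w w' ∧ KasteleynFlat G K X w' ∧ Simple G K w'
proposition3p7 K G X _ w w≉0 flat cycle-sign =
    gauge g w
  , gauge-equivalent g≉0 w
  , Invariance.kasteleynFlat-gauge g≉0 w≉0 flat
  , λ e → sign e (∈-allFin e)
  where
  open Gauge K G
  open Construction K G w≉0 cycle-sign
  open SignGauge (build (allFin (BipGraph.m G)) (UP.allFin⁺ (BipGraph.m G)))
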